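{- Let $k$ be a positive integer and let $G$ be an $n$-vertex graph with $\chi(G) > k$. Then there exists an orientation $\vec{G}$ of $G$ such that the $\big(k(n-\alpha(G))+1\big)$-backward-blowup of $\vec{G}$ is not $k$-dicolourable.
   Context: $\alpha(G)$ is the independence number. For a digraph $D$ and positive integer $m$, the $m$-backward-blowup $D^{\gets m}$ has vertex set $\{(v,i): v\in V(D), i\in[m]\}$ and arc set consisting of the arcs $(u,i)\to(v,i)$ for every arc $u\to v$ of $D$ and $i\in[m]$, together with the arcs $(v,i)\to(u,j)$ for every arc $u\to v$ of $D$ and all $i,j\in[m]$ with $i\ne j$. A digraph is $k$-dicolourable if its vertex set can be partitioned into $k$ sets each inducing a subdigraph with no directed cycle. -}

module Defs where

open import Data.Nat using (ℕ; zero; suc)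
open import Data.Bool using (Bool; true; false)
open import Data.Fin using (Fin; zero; suc; inject₁; fromℕ)
open import Data.Fin.Subset using (Subset; _∈_; ∣_∣)
open import Data.Product using (Σ; ∃; _×_; _,_)
open import Data.Sum using (_⊎_)
open import Relation.Nullary using (¬_)
open import Relation.Binary.PropositionalEquality using (_≡_; _≢_)
open import Function.Definitions using (Injective)

record Graph (n : ℕ) : Set where
  field
    adj    : Fin n → Fin n → Bool
    sym    : ∀ u v → adj u v ≡ adj v u
    irrefl : ∀ v → adj v v ≡ false
open Graph public

ProperColouring : ∀ {n} → Graph n → (k : ℕ) → (Fin n → Fin k) → Set
ProperColouring G k c = ∀ u v → adj G u v ≡ true → c u ≢ c v

Colourable : ∀ {n} → Graph n → ℕ → Set
Colourable G k = Σ (Fin _ → Fin k) (ProperColouring G k)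

ChromaticGreaterThan : ∀ {n} → Graph n → ℕ → Set
ChromaticGreaterThan G k = ¬ Colourable G k

Independent : ∀ {n} → Graph n → Subset n → Set
Independent G S = ∀ u v → u ∈ S → v ∈ S → adj G u v ≡ false

IsIndependenceNumber : ∀ {n} → Graph n → ℕ → Set
IsIndependenceNumber G a =
  (Σ (Subset _) λ S → Independent G S × ∣ S ∣ ≡ a)
  × (∀ S → Independent G S → ∣ S ∣ Data.Nat.≤ a)

Digraph : ℕ → Set
Digraph n = Fin n → Fin n → Bool

IsOrientation : ∀ {n} → Graph n → Digraph n → Set
IsOrientation G D =
  (∀ u v → D u v ≡ true → adj G u v ≡ true)
  × (∀ u v → adj G u v ≡ true → (D u v ≡ true ⊎ D v u ≡ true))
  × (∀ u v → D u v ≡ true → D v u ≡ false)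

BlowupArc : ∀ {n} → Digraph n → (m : ℕ) → Fin n × Fin m → Fin n × Fin m → Set
BlowupArc D m (x , i) (y , j) =
  (i ≡ j × D x y ≡ true) ⊎ (i ≢ j × D y x ≡ true)

-- General digraphs given by a vertex type and an arc relation.
-- A directed cycle of length suc l: distinct vertices f 0, …, f l with arcs
-- f i → f (i+1) for i < l and the closing arc f l → f 0.
record DirectedCycle {V : Set} (Arc : V → V → Set) : Set where
  field
    len   : ℕ
    vtx   : Fin (suc len) → V
    inj   : Injective _≡_ _≡_ vtx
    step  : ∀ (i : Fin len) → Arc (vtx (inject₁ i)) (vtx (suc i))
    close : Arc (vtx (fromℕ len)) (vtx zero)
open DirectedCycle public

Dicolourable : {V : Set} → (V → V → Set) → ℕ → Set
Dicolourable {V} Arc k =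
  Σ (V → Fin k) λ c →
    ∀ (col : Fin k) → ¬ Σ (DirectedCycle Arc) λ C → ∀ i → c (vtx C i) ≡ col

-- Orient G so that the vertices of an independent set S of size α are sinks, so that every arc
-- has its tail among the n − α vertices outside S. In each copy of the blowup the colouring is not a
-- proper k-colouring of G, so some arc t → w of the copy is monochromatic. With more than k(n − α)
-- copies, pigeonhole on (tail, colour) yields copies i ≠ j and arcs t → w₁, t → w₂ of one colour,
-- and (t,i) → (w₁,i) → (t,j) → (w₂,j) → (t,i) is a monochromatic directed cycle: arcs inside a copy
-- follow D, arcs between copies reverse it.
module Submission where

open import Defs hiding (sym)
open import Data.Nat using (ℕ; _+_; _*_; _∸_; NonZero; _<_; _<ᵇ_; z<s)
open import Data.Nat.Properties
  using (<ᵇ⇒<; <⇒<ᵇ; <-cmp; <⇒≢; <-asym; <-≤-trans; m≤m+n; m<m+n; +-cancelˡ-≡; *-comm)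
open import Data.Bool using (true; false; _∧_)
open import Data.Bool.Properties using (T-≡; ∧-conicalˡ; ∧-conicalʳ; ∧-zeroʳ) renaming (_≟_ to _≟ᵇ_)
open import Data.Fin using (Fin; zero; suc; toℕ; combine)
open import Data.Fin.Properties
  using (toℕ-injective; toℕ<n; suc-injective; combine-injective; pigeonhole; any?; _≟_)
  renaming (<⇒≢ to <⇒≢ᶠ)
open import Data.Fin.Subset using (Subset; _∈_; _∉_; ∁; ∣_∣; inside; outside)
open import Data.Fin.Subset.Properties using (_∈?_; x∉p⇒x∈∁p; ∣∁p∣≡n∸∣p∣)
open import Data.Vec using (_∷_; here; there)
open import Data.Product using (Σ; _×_; _,_; ∃₂; proj₁; proj₂)
open import Data.Empty using (⊥)
open import Data.Sum using (_⊎_; inj₁; inj₂)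
open import Function.Base using (_∘_)
open import Function.Bundles using (Equivalence)
open import Function.Definitions using (Injective)
open import Relation.Binary using (tri<; tri≈; tri>)
open import Relation.Binary.PropositionalEquality
  using (_≡_; _≢_; refl; sym; trans; cong; cong₂; subst; module ≡-Reasoning)
open import Relation.Nullary using (¬_; yes; no; contradiction)
open import Relation.Nullary.Decidable using (_×-dec_)

rank : ∀ {n} {x : Fin n} (p : Subset n) → x ∈ p → Fin ∣ p ∣
rank (inside ∷ p) here = zero
rank (inside ∷ p) (there x∈p) = suc (rank p x∈p)
rank (outside ∷ p) (there x∈p) = rank p x∈p

rank-injective : ∀ {n} {x y : Fin n} (p : Subset n) (x∈p : x ∈ p) (y∈p : y ∈ p) →
                 rank p x∈p ≡ rank p y∈p → x ≡ y
rank-injective (inside ∷ p) here here _ = refl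
rank-injective (inside ∷ p) (there x∈p) (there y∈p) eq =
  cong suc (rank-injective p x∈p y∈p (suc-injective eq))
rank-injective (outside ∷ p) (there x∈p) (there y∈p) eq =
  cong suc (rank-injective p x∈p y∈p eq)

module _ {V : Set} where

  square : V → V → V → V → Fin 4 → V
  square x₀ x₁ x₂ x₃ zero = x₀
  square x₀ x₁ x₂ x₃ (suc zero) = x₁
  square x₀ x₁ x₂ x₃ (suc (suc zero)) = x₂
  square x₀ x₁ x₂ x₃ (suc (suc (suc zero))) = x₃

  square-all : (P : V → Set) {x₀ x₁ x₂ x₃ : V} →
    P x₀ → P x₁ → P x₂ → P x₃ → ∀ i → P (square x₀ x₁ x₂ x₃ i)
  square-all P p₀ p₁ p₂ p₃ zero = p₀
  square-all P p₀ p₁ p₂ p₃ (suc zero) = p₁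
  square-all P p₀ p₁ p₂ p₃ (suc (suc zero)) = p₂
  square-all P p₀ p₁ p₂ p₃ (suc (suc (suc zero))) = p₃

  module _ {x₀ x₁ x₂ x₃ : V}
           (d01 : x₀ ≢ x₁) (d02 : x₀ ≢ x₂) (d03 : x₀ ≢ x₃)
           (d12 : x₁ ≢ x₂) (d13 : x₁ ≢ x₃) (d23 : x₂ ≢ x₃) where

    square-injective : Injective _≡_ _≡_ (square x₀ x₁ x₂ x₃)
    square-injective {zero} {zero} _ = refl
    square-injective {zero} {suc zero} e = contradiction e d01
    square-injective {zero} {suc (suc zero)} e = contradiction e d02
    square-injective {zero} {suc (suc (suc zero))} e = contradiction e d03
    square-injective {suc zero} {zero} e = contradiction (sym e) d01
    square-injective {suc zero} {suc zero} _ = refl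
    square-injective {suc zero} {suc (suc zero)} e = contradiction e d12
    square-injective {suc zero} {suc (suc (suc zero))} e = contradiction e d13
    square-injective {suc (suc zero)} {zero} e = contradiction (sym e) d02
    square-injective {suc (suc zero)} {suc zero} e = contradiction (sym e) d12
    square-injective {suc (suc zero)} {suc (suc zero)} _ = refl
    square-injective {suc (suc zero)} {suc (suc (suc zero))} e = contradiction e d23
    square-injective {suc (suc (suc zero))} {zero} e = contradiction (sym e) d03
    square-injective {suc (suc (suc zero))} {suc zero} e = contradiction (sym e) d13
    square-injective {suc (suc (suc zero))} {suc (suc zero)} e = contradiction (sym e) d23
    square-injective {suc (suc (suc zero))} {suc (suc (suc zero))} _ = refl

    cycle₄ : {Arc : V → V → Set} →
      Arc x₀ x₁ → Arc x₁ x₂ → Arc x₂ x₃ → Arc x₃ x₀ → DirectedCycle Arc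
    cycle₄ a01 a12 a23 a30 = record
      { len = 3
      ; vtx = square x₀ x₁ x₂ x₃
      ; inj = square-injective
      ; step = λ { zero → a01 ; (suc zero) → a12 ; (suc (suc zero)) → a23 }
      ; close = a30
      }

adj⇒≢ : ∀ {n} (G : Graph n) {u v} → adj G u v ≡ true → u ≢ v
adj⇒≢ G {u} a refl with trans (sym a) (irrefl G u)
... | ()

¬colourable⇒monochromatic-edge : ∀ {n k} {G : Graph n} → ChromaticGreaterThan G k →
  (c : Fin n → Fin k) → ∃₂ λ u v → adj G u v ≡ true × c u ≡ c v
¬colourable⇒monochromatic-edge {G = G} χ>k c
  with any? (λ u → any? (λ v → (adj G u v ≟ᵇ true) ×-dec (c u ≟ c v)))
... | yes (u , v , a , e) = u , v , a , e
... | no none = contradiction (c , λ u v a e → none (u , v , a , e)) χ>k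

record MonochromaticArc {n k} (D : Digraph n) (c : Fin n → Fin k) : Set where
  constructor monoArc
  field
    tail head  : Fin n
    isArc      : D tail head ≡ true
    sameColour : c tail ≡ c head
open MonochromaticArc

module _ {n} (G : Graph n) {D : Digraph n} (orientation : IsOrientation G D) where

  arc⇒≢ : ∀ {u v} → D u v ≡ true → u ≢ v
  arc⇒≢ d = adj⇒≢ G (proj₁ orientation _ _ d)

  monochromatic-arc : ∀ {k} → ChromaticGreaterThan G k → (c : Fin n → Fin k) →
                      MonochromaticArc D c
  monochromatic-arc χ>k c with ¬colourable⇒monochromatic-edge {G = G} χ>k c
  ... | u , v , a , e with proj₁ (proj₂ orientation) u v a
  ...   | inj₁ d = monoArc u v d e
  ...   | inj₂ d = monoArc v u d (sym e)

module _ {n} (G : Graph n) (w : Fin n → ℕ) where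

  orientAlong : Digraph n
  orientAlong u v = adj G u v ∧ (w u <ᵇ w v)

  orientAlong-< : ∀ {u v} → orientAlong u v ≡ true → w u < w v
  orientAlong-< {u} {v} d = <ᵇ⇒< (w u) (w v) (Equivalence.from T-≡ (∧-conicalʳ _ _ d))

  orientAlong-isOrientation : Injective _≡_ _≡_ w → IsOrientation G orientAlong
  orientAlong-isOrientation w-injective = arc⇒adj , adj⇒arc , antisymmetric
    where
    arc⇒adj : ∀ u v → orientAlong u v ≡ true → adj G u v ≡ true
    arc⇒adj u v d = ∧-conicalˡ _ _ d

    adj⇒arc : ∀ u v → adj G u v ≡ true → orientAlong u v ≡ true ⊎ orientAlong v u ≡ true
    adj⇒arc u v a with <-cmp (w u) (w v)
    ... | tri< lt _ _ = inj₁ (cong₂ _∧_ a (Equivalence.to T-≡ (<⇒<ᵇ lt)))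
    ... | tri≈ _ eq _ = contradiction (w-injective eq) (adj⇒≢ G a)
    ... | tri> _ _ gt = inj₂ (cong₂ _∧_ (trans (Graph.sym G v u) a) (Equivalence.to T-≡ (<⇒<ᵇ gt)))

    antisymmetric : ∀ u v → orientAlong u v ≡ true → orientAlong v u ≡ false
    antisymmetric u v d with w v <ᵇ w u in wv<wu
    ... | false = ∧-zeroʳ (adj G v u)
    ... | true = contradiction (<ᵇ⇒< (w v) (w u) (Equivalence.from T-≡ wv<wu)) (<-asym (orientAlong-< d))

module _ {n} (S : Subset n) where

  sinksLast : Fin n → ℕ
  sinksLast u with u ∈? S
  ... | yes _ = n + toℕ u
  ... | no  _ = toℕ u

  private
    j<n+i : ∀ (i j : Fin n) → toℕ j < n + toℕ i
    j<n+i i j = <-≤-trans (toℕ<n j) (m≤m+n n (toℕ i))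

  sinksLast-injective : Injective _≡_ _≡_ sinksLast
  sinksLast-injective {u} {v} eq with u ∈? S | v ∈? S
  ... | yes _ | yes _ = toℕ-injective (+-cancelˡ-≡ n _ _ eq)
  ... | yes _ | no  _ = contradiction (sym eq) (<⇒≢ (j<n+i u v))
  ... | no  _ | yes _ = contradiction eq (<⇒≢ (j<n+i v u))
  ... | no  _ | no  _ = toℕ-injective eq

  sinksLast-tail∉ : (G : Graph n) → Independent G S →
                    ∀ {u v} → orientAlong G sinksLast u v ≡ true → u ∉ S
  sinksLast-tail∉ G independent {u} {v} d u∈S =
    upward (orientAlong-< G sinksLast d) (∧-conicalˡ _ _ d)
    where
    upward : sinksLast u < sinksLast v → adj G u v ≡ true → ⊥
    upward lt a with u ∈? S | v ∈? S
    ... | no u∉S | _     = u∉S u∈S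
    ... | yes _ | yes v∈S = contradiction (trans (sym a) (independent u v u∈S v∈S)) λ ()
    ... | yes _ | no  _   = <-asym lt (j<n+i u v)

blowup-square : ∀ {n m} {D : Digraph n} {t w₁ w₂ : Fin n} {i j : Fin m} →
  t ≢ w₁ → t ≢ w₂ → i ≢ j → D t w₁ ≡ true → D t w₂ ≡ true → DirectedCycle (BlowupArc D m)
blowup-square t≢w₁ t≢w₂ i≢j d₁ d₂ =
  cycle₄ (t≢w₁ ∘ cong proj₁) (i≢j ∘ cong proj₂) (i≢j ∘ cong proj₂)
         (i≢j ∘ cong proj₂) (i≢j ∘ cong proj₂) (t≢w₂ ∘ cong proj₁)
         (inj₁ (refl , d₁)) (inj₂ (i≢j , d₁)) (inj₁ (refl , d₂)) (inj₂ (i≢j ∘ sym , d₂))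

monochromatic-square : ∀ {n m k} (G : Graph n) {D : Digraph n} → IsOrientation G D →
  (c : Fin n × Fin m → Fin k) → ∀ {i j} → i ≢ j →
  (a : MonochromaticArc D (λ v → c (v , i))) (b : MonochromaticArc D (λ v → c (v , j))) →
  tail a ≡ tail b → c (tail a , i) ≡ c (tail b , j) →
  Σ (DirectedCycle (BlowupArc D m)) λ C → ∀ x → c (vtx C x) ≡ c (tail a , i)
monochromatic-square G orientation c {i} i≢j (monoArc t w₁ d₁ e₁) (monoArc .t w₂ d₂ e₂) refl e =
  blowup-square (arc⇒≢ G orientation d₁) (arc⇒≢ G orientation d₂) i≢j d₁ d₂ ,
  square-all (λ x → c x ≡ c (t , i)) refl (sym e₁) (sym e) (trans (sym e₂) (sym e))

blowup-not-dicolourable : ∀ {n k m} (G : Graph n) {D : Digraph n} →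
  IsOrientation G D → ChromaticGreaterThan G k →
  (T : Subset n) → (∀ {u v} → D u v ≡ true → u ∈ T) → ∣ T ∣ * k < m →
  ¬ Dicolourable (BlowupArc D m) k
blowup-not-dicolourable {k = k} {m = m} G {D} orientation χ>k T tail∈T bound (c , acyclic) =
  let (i , j , i<j , sameCode) = pigeonhole bound code
  in  noCollision i j (<⇒≢ᶠ i<j) sameCode
  where
  arcIn : (i : Fin m) → MonochromaticArc D (λ v → c (v , i))
  arcIn i = monochromatic-arc G orientation χ>k (λ v → c (v , i))

  code : Fin m → Fin (∣ T ∣ * k)
  code i = combine (rank T (tail∈T (isArc (arcIn i)))) (c (tail (arcIn i) , i))

  noCollision : ∀ i j → i ≢ j → code i ≢ code j
  noCollision i j i≢j sameCode =
    let (sameRank , sameColour) = combine-injective _ _ _ _ sameCode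
    in  acyclic _ (monochromatic-square G orientation c i≢j (arcIn i) (arcIn j)
                                        (rank-injective T _ _ sameRank) sameColour)

mainTheorem12 : (k n : ℕ) → .{{_ : NonZero k}} → (G : Graph n) → ChromaticGreaterThan G k →
    (a : ℕ) → IsIndependenceNumber G a →
    Σ (Digraph n) λ D → IsOrientation G D ×
      ¬ Dicolourable (BlowupArc D (k * (n ∸ a) + 1)) k
mainTheorem12 k n G χ>k a ((S , independent , ∣S∣≡a) , _) =
  orientAlong G (sinksLast S) ,
  orientation ,
  blowup-not-dicolourable G orientation χ>k (∁ S)
    (λ d → x∉p⇒x∈∁p (sinksLast-tail∉ S G independent d))
    (subst (_< k * (n ∸ a) + 1) (sym ∣∁S∣*k≡k*[n∸a]) (m<m+n (k * (n ∸ a)) z<s))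
  where
  orientation : IsOrientation G (orientAlong G (sinksLast S))
  orientation = orientAlong-isOrientation G (sinksLast S) (sinksLast-injective S)

  ∣∁S∣*k≡k*[n∸a] : ∣ ∁ S ∣ * k ≡ k * (n ∸ a)
  ∣∁S∣*k≡k*[n∸a] = begin
    ∣ ∁ S ∣ * k      ≡⟨ cong (_* k) (∣∁p∣≡n∸∣p∣ S) ⟩
    (n ∸ ∣ S ∣) * k  ≡⟨ cong (λ s → (n ∸ s) * k) ∣S∣≡a ⟩
    (n ∸ a) * k      ≡⟨ *-comm (n ∸ a) k ⟩
    k * (n ∸ a)      ∎
    where open ≡-Reasoning
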